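{- The Fibonacci morphism $\varphi$ is not interference-free on $\{F_i: i\ge5,\ i\text{ odd}\}$.
   Context: $\varphi(\mathtt{a})=\mathtt{ab}$, $\varphi(\mathtt{b})=\mathtt{a}$ (an injective morphism), $F_i=\varphi^{i-1}(\mathtt{b})$. A word admits an image factorization if it is a concatenation of zero or more of $\varphi(\mathtt{a}),\varphi(\mathtt{b})$. A word $w$ admits an interfered image factorization if $w=xyz$ with $x$ a proper (possibly empty) suffix of some image, $y$ admitting an image factorization, $z$ a proper (possibly empty) prefix of some image, and $xz\neq\varepsilon$. A word is an inner image factor if it is a proper factor of some image that is neither a prefix nor a suffix of it. An injective morphism is interference-free on $\mathcal{L}$ if for every non-empty $u\in\mathcal{L}$, its image admits no interfered image factorization and is not an inner image factor. -}

module Defs where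

open import Data.Nat using (ℕ; zero; suc; _∸_; _≤_; _%_)
open import Data.List using (List; []; _∷_; _++_; concatMap)
open import Data.Product using (Σ; ∃; _×_; _,_)
open import Relation.Nullary using (¬_)
open import Relation.Binary.PropositionalEquality using (_≡_)

data Letter : Set where
  a b : Letter

Word : Set
Word = List Letter

Morphism : Set
Morphism = Letter → Word

ext : Morphism → Word → Word
ext h w = concatMap h w

φ : Morphism
φ a = a ∷ b ∷ []
φ b = a ∷ []

φ^ : ℕ → Word → Word
φ^ zero w = w
φ^ (suc n) w = ext φ (φ^ n w)

-- F i = φ^(i-1)(b)   (used for i ≥ 1)
F : ℕ → Word
F i = φ^ (i ∸ 1) (b ∷ [])

ImageFact : Morphism → Word → Set
ImageFact h w = Σ Word λ v → w ≡ ext h v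

ProperSuffixOfImage : Morphism → Word → Set
ProperSuffixOfImage h x = Σ Letter λ c → Σ Word λ p → (p ++ x ≡ h c) × ¬ (p ≡ [])

ProperPrefixOfImage : Morphism → Word → Set
ProperPrefixOfImage h z = Σ Letter λ c → Σ Word λ s → (z ++ s ≡ h c) × ¬ (s ≡ [])

InterferedImageFact : Morphism → Word → Set
InterferedImageFact h w =
  Σ Word λ x → Σ Word λ y → Σ Word λ z →
    (w ≡ x ++ (y ++ z)) × ProperSuffixOfImage h x × ImageFact h y
      × ProperPrefixOfImage h z × ¬ (x ++ z ≡ [])

IsPrefix : Word → Word → Set
IsPrefix u v = Σ Word λ s → u ++ s ≡ v

IsSuffix : Word → Word → Set
IsSuffix u v = Σ Word λ p → p ++ u ≡ v

IsFactor : Word → Word → Set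
IsFactor u v = Σ Word λ p → Σ Word λ s → p ++ (u ++ s) ≡ v

-- u is a proper factor of some image that is neither a prefix nor a suffix of it
-- (properness is implied by not being a prefix)
InnerImageFactor : Morphism → Word → Set
InnerImageFactor h u =
  Σ Letter λ c → IsFactor u (h c) × ¬ (u ≡ h c) × ¬ IsPrefix u (h c) × ¬ IsSuffix u (h c)

InterferenceFree : Morphism → (Word → Set) → Set
InterferenceFree h L =
  (u : Word) → L u → ¬ (u ≡ []) →
    ¬ InterferedImageFact h (ext h u) × ¬ InnerImageFactor h (ext h u)

OddFibLang : Word → Set
OddFibLang u = Σ ℕ λ i → (5 ≤ i) × (i % 2 ≡ 1) × (u ≡ F i)

-- Since φ(b) = a is a proper prefix of φ(a) = ab, the image of any word ending in b
-- splits as φ(u) · a with the trailing a read as a cut-off φ(a); and F₅ = abaab ends in b.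
module Submission where

open import Defs
open import Data.Nat using (s≤s; z≤n)
open import Data.List using ([]; _∷_; _++_; [_])
open import Data.List.Properties using (++-assoc; ++-identityʳ)
open import Data.Product using (_,_; proj₁)
open import Relation.Nullary using (¬_)
open import Relation.Binary.PropositionalEquality using (_≡_; refl; sym; cong; module ≡-Reasoning)

ext-++ : ∀ h u v → ext h (u ++ v) ≡ ext h u ++ ext h v
ext-++ h [] v = refl
ext-++ h (c ∷ u) v = begin
  h c ++ ext h (u ++ v)       ≡⟨ cong (h c ++_) (ext-++ h u v) ⟩
  h c ++ (ext h u ++ ext h v) ≡⟨ sym (++-assoc (h c) (ext h u) (ext h v)) ⟩
  (h c ++ ext h u) ++ ext h v ∎
  where open ≡-Reasoning

ext-φ-∷ʳb-interfered : ∀ u → InterferedImageFact φ (ext φ (u ++ [ b ]))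
ext-φ-∷ʳb-interfered u =
  [] , ext φ u , [ a ] , ext-++ φ u [ b ]
     , (a , φ a , ++-identityʳ (φ a) , λ ())
     , (u , refl)
     , (a , [ b ] , refl , λ ())
     , λ ()

F5∈OddFibLang : OddFibLang (F 5)
F5∈OddFibLang = 5 , s≤s (s≤s (s≤s (s≤s (s≤s z≤n)))) , refl , refl

F5≡abaa∷ʳb : F 5 ≡ (a ∷ b ∷ a ∷ a ∷ []) ++ [ b ]
F5≡abaa∷ʳb = refl

mainTheorem19 : ¬ InterferenceFree φ OddFibLang
mainTheorem19 free = proj₁ (free (F 5) F5∈OddFibLang (λ ())) φF5-interfered
  where
  φF5-interfered : InterferedImageFact φ (ext φ (F 5))
  φF5-interfered rewrite F5≡abaa∷ʳb = ext-φ-∷ʳb-interfered (a ∷ b ∷ a ∷ a ∷ [])
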